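{- Let $\Gamma\neq\mathbb{N}$ be a numerical semigroup with multiplicity $m$, conductor $c$ and delta-invariant $\delta$, and let $L=\lfloor (c-1)/m\rfloor$. If $W_\Gamma(k)=0$ for some $k\in\mathbb{N}$, then $k\delta\le (L+1)m$, and hence $k\le m$.
   Context: A numerical semigroup is an additive submonoid $\Gamma\subseteq\mathbb{N}$ with finite complement, with multiplicity $m=\min(\Gamma\setminus\{0\})$, conductor $c$ (one more than the largest integer not in $\Gamma$) and delta-invariant $\delta=|\{x\in\Gamma:x<c\}|$. The Wilf function is $W_\Gamma(k)=k\delta-c$. -}

module Defs where

open import Data.Bool using (Bool; true; false)
open import Data.Nat using (ℕ; zero; suc; _+_; _*_; _∸_; _≤_; _<_)
open import Data.List using (List; length; filter; upTo)
open import Data.Integer using (ℤ; +_; _-_)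
open import Data.Product using (∃; _×_)
open import Relation.Binary.PropositionalEquality using (_≡_)
open import Relation.Nullary using (¬_)
open import Data.Bool.Properties using (T?)

_∈_ : ℕ → (ℕ → Bool) → Set
x ∈ Γ = Γ x ≡ true

_∉_ : ℕ → (ℕ → Bool) → Set
x ∉ Γ = Γ x ≡ false

record IsNumericalSemigroup (Γ : ℕ → Bool) : Set where
  field
    zero∈    : 0 ∈ Γ
    +-closed : ∀ x y → x ∈ Γ → y ∈ Γ → (x + y) ∈ Γ
    cofinite : ∃ λ N → ∀ x → N ≤ x → x ∈ Γ

IsMultiplicity : (ℕ → Bool) → ℕ → Set
IsMultiplicity Γ m = (0 < m) × (m ∈ Γ) × (∀ x → 0 < x → x < m → x ∉ Γ)

-- c is the conductor: one more than the largest gap, i.e. the least c with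
-- every x ≥ c in Γ (c = 0 when Γ = ℕ).
IsConductor : (ℕ → Bool) → ℕ → Set
IsConductor Γ c = (∀ x → c ≤ x → x ∈ Γ) × (∀ d → (∀ x → d ≤ x → x ∈ Γ) → c ≤ d)

delta : (ℕ → Bool) → ℕ → ℕ
delta Γ c = length (filter (λ x → T? (Γ x)) (upTo c))

wilf : (Γ : ℕ → Bool) (c : ℕ) → ℕ → ℤ
wilf Γ c k = (+ (k * delta Γ c)) - (+ c)

-- The multiples 0, m, …, L m of the multiplicity all lie in Γ below the conductor,
-- so δ ≥ L + 1, while c ≤ (L + 1) m since L = ⌊(c − 1)/m⌋. If W(k) = 0 then
-- k δ = c ≤ (L + 1) m, and k (L + 1) ≤ k δ lets us cancel L + 1 to get k ≤ m.
module Submission where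

open import Defs
open import Data.Nat using (ℕ; zero; suc; _+_; _*_; _∸_; _≤_; _<_; _≤′_; ≤′-refl; ≤′-step; z≤n; s≤s; NonZero; >-nonZero)
open import Data.Nat.Properties
open import Data.Nat.DivMod using (_/_; _%_; m≡m%n+[m/n]*n; m%n<n; m/n*n≤m)
open import Data.Integer using (+_)
import Data.Integer.Properties as ℤ
open import Data.Bool using (Bool)
open import Data.Bool.Properties using (T?)
open import Data.List using (length; filter; upTo; _++_; [_])
open import Data.List.Properties using (upTo-∷ʳ; filter-++; length-++)
open import Data.Product using (∃; _×_; _,_)
open import Relation.Binary.PropositionalEquality using (_≡_; sym; trans; cong; subst; module ≡-Reasoning)

m<[m/n+1]*n : ∀ m n .{{_ : NonZero n}} → m < (m / n + 1) * n
m<[m/n+1]*n m n = begin-strict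
  m                   ≡⟨ m≡m%n+[m/n]*n m n ⟩
  m % n + (m / n) * n <⟨ +-monoˡ-< ((m / n) * n) (m%n<n m n) ⟩
  n + (m / n) * n     ≡⟨ cong (_* n) (+-comm 1 (m / n)) ⟩
  (m / n + 1) * n     ∎
  where open ≤-Reasoning

m≤[[m∸1]/n+1]*n : ∀ m n .{{_ : NonZero n}} → m ≤ ((m ∸ 1) / n + 1) * n
m≤[[m∸1]/n+1]*n zero    n = z≤n
m≤[[m∸1]/n+1]*n (suc m) n = m<[m/n+1]*n m n

[m∸1]/n*n<m : ∀ m n .{{_ : NonZero n}} → 0 < m → ((m ∸ 1) / n) * n < m
[m∸1]/n*n<m (suc m) n _ = s≤s (m/n*n≤m m n)

module _ (Γ : ℕ → Bool) where

  delta-suc : ∀ n → delta Γ (suc n) ≡ delta Γ n + length (filter (λ x → T? (Γ x)) [ n ])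
  delta-suc n = begin
    length (filter (λ x → T? (Γ x)) (upTo (suc n)))
      ≡⟨ cong (λ xs → length (filter (λ x → T? (Γ x)) xs)) (sym (upTo-∷ʳ n)) ⟩
    length (filter (λ x → T? (Γ x)) (upTo n ++ [ n ]))
      ≡⟨ cong length (filter-++ (λ x → T? (Γ x)) (upTo n) [ n ]) ⟩
    length (filter (λ x → T? (Γ x)) (upTo n) ++ filter (λ x → T? (Γ x)) [ n ])
      ≡⟨ length-++ (filter (λ x → T? (Γ x)) (upTo n)) ⟩
    delta Γ n + length (filter (λ x → T? (Γ x)) [ n ]) ∎
    where open ≡-Reasoning

  delta-suc-∈ : ∀ {n} → n ∈ Γ → delta Γ (suc n) ≡ suc (delta Γ n)
  delta-suc-∈ {n} n∈Γ rewrite delta-suc n | n∈Γ = +-comm (delta Γ n) 1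

  delta-mono-≤ : ∀ {a b} → a ≤ b → delta Γ a ≤ delta Γ b
  delta-mono-≤ a≤b = go (≤⇒≤′ a≤b)
    where
    go : ∀ {a b} → a ≤′ b → delta Γ a ≤ delta Γ b
    go ≤′-refl = ≤-refl
    go (≤′-step {n} a≤′n) = ≤-trans (go a≤′n) (subst (delta Γ n ≤_) (sym (delta-suc n)) (m≤m+n _ _))

module _ {Γ : ℕ → Bool} (Γ-ns : IsNumericalSemigroup Γ) where
  open IsNumericalSemigroup Γ-ns

  *-closed : ∀ {m} → m ∈ Γ → ∀ j → (j * m) ∈ Γ
  *-closed m∈Γ zero    = zero∈
  *-closed m∈Γ (suc j) = +-closed _ _ m∈Γ (*-closed m∈Γ j)

  suc≤delta[suc[j*m]] : ∀ {m} → 0 < m → m ∈ Γ → ∀ j → suc j ≤ delta Γ (suc (j * m))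
  suc≤delta[suc[j*m]] 0<m m∈Γ zero = ≤-reflexive (sym (delta-suc-∈ Γ zero∈))
  suc≤delta[suc[j*m]] {m} 0<m m∈Γ (suc j) = begin
    suc (suc j)                 ≤⟨ s≤s (suc≤delta[suc[j*m]] 0<m m∈Γ j) ⟩
    suc (delta Γ (suc (j * m))) ≤⟨ s≤s (delta-mono-≤ Γ (+-monoˡ-≤ (j * m) 0<m)) ⟩
    suc (delta Γ (m + j * m))   ≡⟨ delta-suc-∈ Γ (*-closed m∈Γ (suc j)) ⟨
    delta Γ (suc (m + j * m))   ∎
    where open ≤-Reasoning

  j*m<n⇒suc≤delta : ∀ {m n} j → 0 < m → m ∈ Γ → j * m < n → suc j ≤ delta Γ n
  j*m<n⇒suc≤delta j 0<m m∈Γ j*m<n = ≤-trans (suc≤delta[suc[j*m]] 0<m m∈Γ j) (delta-mono-≤ Γ j*m<n)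

gap⇒0<conductor : ∀ {Γ c x} → x ∉ Γ → (∀ y → c ≤ y → y ∈ Γ) → 0 < c
gap⇒0<conductor {c = zero}  {x} x∉Γ c-cond with () ← trans (sym x∉Γ) (c-cond x z≤n)
gap⇒0<conductor {c = suc c} x∉Γ c-cond = s≤s z≤n

wilf≡0⇒k*delta≡c : ∀ Γ c k → wilf Γ c k ≡ + 0 → k * delta Γ c ≡ c
wilf≡0⇒k*delta≡c Γ c k w = ℤ.+-injective (ℤ.i-j≡0⇒i≡j (+ (k * delta Γ c)) (+ c) w)

proposition3p9 : (Γ : ℕ → Bool) (m c : ℕ) .{{_ : NonZero m}} →
    IsNumericalSemigroup Γ → (∃ λ x → x ∉ Γ) →
    IsMultiplicity Γ m → IsConductor Γ c →
    (k : ℕ) → wilf Γ c k ≡ + 0 →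
    (k * delta Γ c ≤ ((c ∸ 1) / m + 1) * m) × (k ≤ m)
proposition3p9 Γ m c Γ-ns (x , x∉Γ) (0<m , m∈Γ , _) (c-cond , _) k w = kδ≤[L+1]m , k≤m
  where
  L : ℕ
  L = (c ∸ 1) / m

  kδ≤[L+1]m : k * delta Γ c ≤ (L + 1) * m
  kδ≤[L+1]m = subst (_≤ (L + 1) * m) (sym (wilf≡0⇒k*delta≡c Γ c k w)) (m≤[[m∸1]/n+1]*n c m)

  L+1≤δ : L + 1 ≤ delta Γ c
  L+1≤δ = subst (_≤ delta Γ c) (+-comm 1 L)
    (j*m<n⇒suc≤delta Γ-ns L 0<m m∈Γ ([m∸1]/n*n<m c m (gap⇒0<conductor x∉Γ c-cond)))

  k≤m : k ≤ m
  k≤m = *-cancelʳ-≤ k m (L + 1) {{nonZero-L+1}} (begin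
    k * (L + 1)   ≤⟨ *-monoʳ-≤ k L+1≤δ ⟩
    k * delta Γ c ≤⟨ kδ≤[L+1]m ⟩
    (L + 1) * m   ≡⟨ *-comm (L + 1) m ⟩
    m * (L + 1)   ∎)
    where
    open ≤-Reasoning
    nonZero-L+1 : NonZero (L + 1)
    nonZero-L+1 = >-nonZero (m≤n+m 1 L)
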